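{- Let $r,c\ge2$ and $m\ge1$ be integers. Then $A_{r,c,m}\setminus A_{r,c,m-1}\subseteq\{(c+2m)\bmod r,\ -(c+2m)\bmod r\}$.
   Context: An $r\times c$ cylinder graph has vertices $(i,j)$, $0\le i\le r-1$, $0\le j\le c-1$; $(i,j)$ is adjacent to $(i,j\pm1)$ when that column index lies in $\{0,\dots,c-1\}$ (horizontal edges) and to $(i\pm1\bmod r,j)$ (vertical edges). A GG path with $2k+1+(c-2)$ horizontal edges ($k\ge0$) is a Hamiltonian path of one of two forms. Form 1: starts at $(0,0)$; uses $r-2k-1$ vertical edges along $(0,0),(1,0),\dots,(r-2k-1,0)$; then alternates horizontal and vertical edges using $2k+1$ horizontal edges along $(r-2k-1,0),(r-2k-1,1),(r-2k,1),(r-2k,0),(r-2k+1,0),\dots,(r-1,0),(r-1,1)$; then traverses the remaining vertices column by column (traverse a column, take one horizontal edge to the next column, traverse it, etc.), ending in the last column and using $c-2$ further horizontal edges. Form 2: starts at $(0,0)$; uses $r-2k-1$ vertical edges along $(0,0),(r-1,0),\dots,(2k+1,0)$; then alternates along $(2k+1,0),(2k+1,1),(2k,1),(2k,0),\dots,(1,0),(1,1)$ using $2k+1$ horizontal edges; then traverses the remaining vertices column by column as in Form 1. $A_{r,c,m}$ is the set of row indices $x$ such that some GG path in the $r\times c$ cylinder graph using at most $2m+(c-1)$ horizontal edges ends at $(x,c-1)$. -}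

module Defs where

open import Data.Nat using (ℕ; zero; suc; _+_; _*_; _∸_; _≤_; _<_)
open import Data.Nat.DivMod using (_%_)
open import Data.Bool using (Bool; true; false; not; if_then_else_)
open import Data.Product using (_×_; _,_; Σ; ∃; proj₁; proj₂)
open import Data.Sum using (_⊎_)
open import Data.List using (List; []; _∷_; _++_; map; upTo; concat; concatMap; last)
open import Data.List.Membership.Propositional using (_∈_)
open import Data.List.Relation.Unary.All using (All)
open import Data.List.Relation.Unary.Linked using (Linked)
open import Data.List.Relation.Unary.Unique.Propositional using (Unique)
open import Data.Vec using (Vec; lookup; toList)
open import Data.Fin using (Fin; toℕ)
open import Data.Maybe using (just)
open import Relation.Binary.PropositionalEquality using (_≡_)

-- a mod n (for n = 0 we return a; never used since r ≥ 2)
modN : ℕ → ℕ → ℕ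
modN a zero    = a
modN a (suc n) = a % suc n

negMod : ℕ → ℕ → ℕ
negMod a n = modN (n ∸ modN a n) n

-- Vertices (row i, column j) of the r × c cylinder graph
Vertex : Set
Vertex = ℕ × ℕ

Valid : ℕ → ℕ → Vertex → Set
Valid r c (i , j) = i < r × j < c

NextRow : ℕ → ℕ → ℕ → Set
NextRow r i i' = (suc i < r × i' ≡ suc i) ⊎ (suc i ≡ r × i' ≡ 0)

Adj : ℕ → ℕ → Vertex → Vertex → Set
Adj r c (i , j) (i' , j') =
  Valid r c (i , j) × Valid r c (i' , j') ×
  ( (i ≡ i' × (j' ≡ suc j ⊎ j ≡ suc j'))
  ⊎ (j ≡ j' × (NextRow r i i' ⊎ NextRow r i' i)) )

HamiltonianPath : ℕ → ℕ → List Vertex → Set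
HamiltonianPath r c p =
  All (Valid r c) p × Unique p × Linked (Adj r c) p ×
  (∀ v → Valid r c v → v ∈ p)

-- Form 1 initial part (covering column 0 and the zigzag part):
-- (0,0),(1,0),…,(r-2k-1,0),(r-2k-1,1),(r-2k,1),(r-2k,0),…,(r-1,0),(r-1,1)
isEven : ℕ → Bool
isEven zero    = true
isEven (suc n) = not (isEven n)

zigzagPair : ℕ → ℕ → List Vertex
zigzagPair b t =
  if isEven t then (b + t , 0) ∷ (b + t , 1) ∷ []
                    else (b + t , 1) ∷ (b + t , 0) ∷ []

prefix1 : ℕ → ℕ → List Vertex
prefix1 r k =
  map (λ i → (i , 0)) (upTo (r ∸ (2 * k + 1)))
  ++ concatMap (zigzagPair (r ∸ (2 * k + 1))) (upTo (2 * k + 1))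

-- Form 2 initial part: the mirror image of Form 1 under row i ↦ (-i) mod r, i.e.
-- (0,0),(r-1,0),…,(2k+1,0),(2k+1,1),(2k,1),(2k,0),…,(1,0),(1,1)
prefix2 : ℕ → ℕ → List Vertex
prefix2 r k = map (λ v → (negMod (proj₁ v) r , proj₂ v)) (prefix1 r k)

-- the rest of the path traverses the remaining vertices column by column:
-- it is a concatenation of segments lying in columns 1, 2, …, c-1 in this order
ColumnByColumn : ℕ → List Vertex → Set
ColumnByColumn c rest =
  Σ (Vec (List Vertex) (c ∸ 1)) λ segs →
    rest ≡ concat (toList segs) ×
    (∀ (j : Fin (c ∸ 1)) → All (λ v → proj₂ v ≡ suc (toℕ j)) (lookup segs j))

-- GG path (with 2k+1+(c-2) horizontal edges) in the r × c cylinder graph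
GGPath : ℕ → ℕ → ℕ → List Vertex → Set
GGPath r c k p =
  2 * k + 1 ≤ r × HamiltonianPath r c p ×
  (∃ λ rest → ColumnByColumn c rest ×
     (p ≡ prefix1 r k ++ rest ⊎ p ≡ prefix2 r k ++ rest))

-- x ∈ A_{r,c,m}: some GG path using at most 2m+(c-1) horizontal edges ends at (x, c-1)
InA : ℕ → ℕ → ℕ → ℕ → Set
InA r c m x =
  ∃ λ k → ∃ λ p → GGPath r c k p ×
    2 * k + 1 + (c ∸ 2) ≤ 2 * m + (c ∸ 1) ×
    last p ≡ just (x , c ∸ 1)

-- Write b = r - 2k - 1. The prefix of a Form 1 GG path covers column 0 and rows b, …, r-1 of
-- column 1 and ends at (r-1, 1). Since the path is simple, it must then climb through rows
-- 0, …, b-1 of column 1, ending at row b-1, and afterwards traverse every further column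
-- completely: entered at row e, a column is left at row e-1 or e+1. So the last row is reached
-- from b-1 by c-2 steps of ±1, and conversely every such sequence of steps is realised. Raising
-- k by one lowers b by two, so a sequence with an upward step is also realised with k-1: turn its
-- first upward step into a downward one. Hence a row that is new in A_{r,c,m} comes from a path
-- with k = m all of whose steps go down, and it is b-1-(c-2) ≡ -(c+2m) mod r. Form 2 paths are
-- the mirror images of Form 1 paths under i ↦ -i mod r, which accounts for (c+2m) mod r.

module Submission where

open import Defs
open import Data.Bool using (Bool; true; false; not; if_then_else_)
open import Data.Bool.Properties using (not-involutive)
open import Data.Empty using (⊥; ⊥-elim)
open import Data.Maybe as Maybe using (just)
open import Data.Maybe.Properties using (just-injective)
open import Data.Maybe.Relation.Binary.Connected using (Connected)
open import Data.Nat using (ℕ; zero; suc; _+_; _*_; _∸_; _≤_; _<_; z≤n; s≤s; z<s; _<?_; _≤?_; _≟_)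
open import Data.Nat.Properties
open import Data.Nat.Tactic.RingSolver using (solve-∀)
open import Data.Nat.DivMod using (_%_; m<n⇒m%n≡m; m%n<n; m%n%n≡m%n; n%n≡0; %-distribˡ-+)
open import Data.Product as Product using (_×_; _,_; ∃; proj₁; proj₂)
open import Data.Product.Properties using (,-injectiveˡ)
open import Data.Sum as Sum using (_⊎_; inj₁; inj₂; [_,_]′)
open import Data.List
  using (List; []; _∷_; _++_; map; last; head; concat; concatMap; length; upTo; downFrom; applyUpTo; applyDownFrom)
open import Data.Unit using (⊤; tt)
open import Data.Vec as Vec using (Vec; []; _∷_; toList; lookup)
open import Data.Vec.Properties using (toList-map; lookup-map; length-toList)
open import Data.Fin using (toℕ) renaming (zero to fzero; suc to fsuc)
open import Data.List.Membership.Propositional using (_∈_; _∉_; find; lose)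
open import Data.List.Membership.Propositional.Properties using (∈-++⁺ˡ; ∈-++⁺ʳ; ∈-++⁻; ∈-map⁺; ∈-map⁻;
  ∈-applyUpTo⁺; ∈-applyUpTo⁻; ∈-applyDownFrom⁺; ∈-applyDownFrom⁻;
  ∈-upTo⁺; ∈-upTo⁻; ∈-downFrom⁺; ∈-downFrom⁻; ∈-concatMap⁺; ∈-concatMap⁻)
open import Data.List.Properties
  using (last-map; ++-assoc; concat-map; applyUpTo-∷ʳ; applyDownFrom-∷ʳ; upTo-∷ʳ; map-++; concat-++; ++-identityʳ)
import Data.List.Relation.Unary.All as All
import Data.List.Relation.Unary.All.Properties as Allₚ
open import Data.List.Relation.Unary.All using (All; []; _∷_; tabulate) renaming (lookup to All-lookup)
open import Data.List.Relation.Unary.Any using (here; there)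
open import Data.List.Relation.Unary.Linked as Linked using (Linked; []; [-]; _∷_)
import Data.List.Relation.Unary.Linked.Properties as Linkedₚ
open import Data.List.Relation.Unary.Unique.Propositional using (Unique; []; _∷_)
open import Data.List.Relation.Unary.Unique.Propositional.Properties using (Unique[x∷xs]⇒x∉xs)
import Data.List.Relation.Unary.Unique.Propositional.Properties as Uniqueₚ
open import Function using (flip; _∘_)
open import Relation.Binary.Construct.Closure.Symmetric using (SymClosure; fwd; bwd)
open import Relation.Binary.PropositionalEquality
open import Relation.Nullary using (¬_; yes; no)

m≤n<m+o⇒n∸m<o : ∀ {m n o} → m ≤ n → n < m + o → n ∸ m < o
m≤n<m+o⇒n∸m<o {m} m≤n n<m+o = +-cancelˡ-< m _ _ (subst (_< m + _) (sym (m+[n∸m]≡n m≤n)) n<m+o)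

m<n⇒n∸m≡1+n∸1+m : ∀ {m n} → m < n → n ∸ m ≡ suc (n ∸ suc m)
m<n⇒n∸m≡1+n∸1+m {zero}  {suc n} _        = refl
m<n⇒n∸m≡1+n∸1+m {suc m} {suc n} (s≤s lt) = m<n⇒n∸m≡1+n∸1+m lt

∸≡suc⇒ : ∀ {r e m} → e ≤ r → r ∸ e ≡ suc m → suc (e + m) ≡ r
∸≡suc⇒ {r} {e} {m} e≤r eq = trans (sym (+-suc e m)) (trans (cong (e +_) (sym eq)) (m+[n∸m]≡n e≤r))

module _ {A : Set} where

  last-++ : ∀ (xs : List A) {ys a} → last xs ≡ just a → last (xs ++ ys) ≡ last (a ∷ ys)
  last-++ (x ∷ [])     refl = refl
  last-++ (x ∷ y ∷ xs) e    = last-++ (y ∷ xs) e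

  last-++ʳ : ∀ (xs : List A) {y ys} → last (xs ++ y ∷ ys) ≡ last (y ∷ ys)
  last-++ʳ []           = refl
  last-++ʳ (x ∷ [])     = refl
  last-++ʳ (x ∷ x′ ∷ xs) = last-++ʳ (x′ ∷ xs)

  last-∈ : ∀ (xs : List A) {a} → last xs ≡ just a → a ∈ xs
  last-∈ (x ∷ [])     refl = here refl
  last-∈ (x ∷ y ∷ xs) e    = there (last-∈ (y ∷ xs) e)

  Unique-++⁻ˡ : ∀ xs {ys : List A} → Unique (xs ++ ys) → Unique xs
  Unique-++⁻ˡ []       _          = []
  Unique-++⁻ˡ (x ∷ xs) (x∉ ∷ u) = Allₚ.++⁻ˡ xs x∉ ∷ Unique-++⁻ˡ xs u

  Unique-++⁻ʳ : ∀ xs {ys : List A} → Unique (xs ++ ys) → Unique ys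
  Unique-++⁻ʳ []       u       = u
  Unique-++⁻ʳ (x ∷ xs) (_ ∷ u) = Unique-++⁻ʳ xs u

  Unique-++-disjoint : ∀ xs {ys : List A} {v} → Unique (xs ++ ys) → v ∈ xs → v ∈ ys → ⊥
  Unique-++-disjoint (x ∷ xs) (x∉ ∷ _) (here refl) v∈ys = All-lookup (Allₚ.++⁻ʳ xs x∉) v∈ys refl
  Unique-++-disjoint (x ∷ xs) (_ ∷ u)  (there v∈xs) v∈ys = Unique-++-disjoint xs u v∈xs v∈ys

  module _ {R : A → A → Set} where

    Linked-++⁻ˡ : ∀ xs {ys} → Linked R (xs ++ ys) → Linked R xs
    Linked-++⁻ˡ []           _        = []
    Linked-++⁻ˡ (x ∷ [])     _        = [-]
    Linked-++⁻ˡ (x ∷ y ∷ xs) (Rxy ∷ l) = Rxy ∷ Linked-++⁻ˡ (y ∷ xs) l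

    Linked-++⁻ʳ : ∀ xs {ys a} → Linked R (xs ++ ys) → last xs ≡ just a → Linked R (a ∷ ys)
    Linked-++⁻ʳ (x ∷ [])     l       refl = l
    Linked-++⁻ʳ (x ∷ y ∷ xs) (_ ∷ l) e    = Linked-++⁻ʳ (y ∷ xs) l e

    Linked-++⁺ : ∀ xs {ys a} → Linked R xs → last xs ≡ just a → Linked R (a ∷ ys) → Linked R (xs ++ ys)
    Linked-++⁺ xs {ys} lx la ly =
      Linkedₚ.++⁺ lx (subst (λ m → Connected R m (head ys)) (sym la) (Linked.head′ ly)) (Linked.tail ly)

    -- By injectivity of R a simple path cannot turn back, and by functionality it ends at the
    -- first vertex whose R-successor it does not visit.
    oriented-path-last : (∀ {a b c} → R a b → R a c → b ≡ c) → (∀ {a b c} → R a c → R b c → a ≡ b) →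
      ∀ {a b xs z w} → R a b → Linked (SymClosure R) (b ∷ xs) → Unique (a ∷ b ∷ xs) →
      z ∈ a ∷ b ∷ xs → R z w → w ∉ b ∷ xs → last (a ∷ b ∷ xs) ≡ just z
    oriented-path-last functional injective Rab l u = exit-last (oriented Rab l u)
      where
      oriented : ∀ {a b xs} → R a b → Linked (SymClosure R) (b ∷ xs) → Unique (a ∷ b ∷ xs) → Linked R (a ∷ b ∷ xs)
      oriented Rab [-]           _                    = Rab ∷ [-]
      oriented Rab (fwd Rbx ∷ l) (_ ∷ u)              = Rab ∷ oriented Rbx l u
      oriented Rab (bwd Rxb ∷ l) ((_ ∷ a≢x ∷ _) ∷ _) = ⊥-elim (a≢x (injective Rab Rxb))
      exit-last : ∀ {h t z w} → Linked R (h ∷ t) → z ∈ h ∷ t → R z w → w ∉ t → last (h ∷ t) ≡ just z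
      exit-last {t = []}    _         (here refl) _   _  = refl
      exit-last {t = x ∷ t} (Rhx ∷ _) (here refl) Rzw w∉ = ⊥-elim (w∉ (here (functional Rzw Rhx)))
      exit-last {t = x ∷ t} (_ ∷ l)   (there z∈)  Rzw w∉ = exit-last l z∈ Rzw (λ w∈ → w∉ (there w∈))

-- Rows of the cylinder

next : ℕ → ℕ → ℕ
next r i with suc i <? r
... | yes _ = suc i
... | no  _ = 0

prev : ℕ → ℕ → ℕ
prev r zero    = r ∸ 1
prev r (suc i) = i

module _ {r : ℕ} where

  NextRow-functional : ∀ {i a b} → NextRow r i a → NextRow r i b → a ≡ b
  NextRow-functional (inj₁ (_ , refl)) (inj₁ (_ , refl)) = refl
  NextRow-functional (inj₁ (lt , _))   (inj₂ (refl , _)) = ⊥-elim (<-irrefl refl lt)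
  NextRow-functional (inj₂ (refl , _)) (inj₁ (lt , _))   = ⊥-elim (<-irrefl refl lt)
  NextRow-functional (inj₂ (_ , refl)) (inj₂ (_ , refl)) = refl

  NextRow-injective : ∀ {i a b} → NextRow r a i → NextRow r b i → a ≡ b
  NextRow-injective (inj₁ (_ , refl)) (inj₁ (_ , e))    = suc-injective e
  NextRow-injective (inj₁ (_ , refl)) (inj₂ (_ , ()))
  NextRow-injective (inj₂ (_ , refl)) (inj₁ (_ , ()))
  NextRow-injective (inj₂ (e , _))    (inj₂ (e′ , _))   = suc-injective (trans e (sym e′))

  NextRow⇒<ˡ : ∀ {i i′} → NextRow r i i′ → i < r
  NextRow⇒<ˡ (inj₁ (lt , _))   = <-trans (n<1+n _) lt
  NextRow⇒<ˡ (inj₂ (refl , _)) = n<1+n _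

  NextRow⇒<ʳ : ∀ {i i′} → NextRow r i i′ → i′ < r
  NextRow⇒<ʳ (inj₁ (lt , refl))   = lt
  NextRow⇒<ʳ (inj₂ (refl , refl)) = s≤s z≤n

  NextRow-irrefl : 2 ≤ r → ∀ {i} → ¬ NextRow r i i
  NextRow-irrefl _  (inj₁ (_ , e))    = 1+n≢n (sym e)
  NextRow-irrefl 2≤r (inj₂ (e , refl)) = <-irrefl e 2≤r

  NextRow-next : ∀ {i} → i < r → NextRow r i (next r i)
  NextRow-next {i} i<r with suc i <? r
  ... | yes lt = inj₁ (lt , refl)
  ... | no ¬lt = inj₂ (≤-antisym i<r (≮⇒≥ ¬lt) , refl)

  NextRow-prev : ∀ {i} → i < r → NextRow r (prev r i) i
  NextRow-prev {zero}  (s≤s _) = inj₂ (refl , refl)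
  NextRow-prev {suc i} lt      = inj₁ (lt , refl)

  next< : ∀ {i} → i < r → next r i < r
  next< i<r = NextRow⇒<ʳ (NextRow-next i<r)

  prev< : ∀ {i} → i < r → prev r i < r
  prev< i<r = NextRow⇒<ˡ (NextRow-prev i<r)

  NextRow⇒≡next : ∀ {i i′} → NextRow r i i′ → i′ ≡ next r i
  NextRow⇒≡next n = NextRow-functional n (NextRow-next (NextRow⇒<ˡ n))

  NextRow⇒≡prev : ∀ {i i′} → NextRow r i i′ → i ≡ prev r i′
  NextRow⇒≡prev n = NextRow-injective n (NextRow-prev (NextRow⇒<ʳ n))

  next-prev : ∀ {i} → i < r → next r (prev r i) ≡ i
  next-prev i<r = sym (NextRow⇒≡next (NextRow-prev i<r))

  prev-next : ∀ {i} → i < r → prev r (next r i) ≡ i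
  prev-next i<r = sym (NextRow⇒≡prev (NextRow-next i<r))

-- A traversal of a whole column entered at row e leaves it at row step r b e.
step : ℕ → Bool → ℕ → ℕ
step r true  = next r
step r false = prev r

walk : ℕ → ℕ → List Bool → ℕ
walk r e []       = e
walk r e (b ∷ bs) = walk r (step r b e) bs

step< : ∀ {r e} b → e < r → step r b e < r
step< true  = next<
step< false = prev<

module _ {r : ℕ} where

  private
    flip-SymClosure : ∀ {a b} → SymClosure (NextRow r) a b → SymClosure (flip (NextRow r)) a b
    flip-SymClosure (fwd n) = bwd n
    flip-SymClosure (bwd n) = fwd n

  cycle-Hamiltonian-path-last : 2 ≤ r → ∀ {e xs} → e < r → Unique (e ∷ xs) → Linked (SymClosure (NextRow r)) (e ∷ xs) →
    (∀ {i} → i < r → i ∈ e ∷ xs) → ∃ λ b → last (e ∷ xs) ≡ just (step r b e)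
  cycle-Hamiltonian-path-last 2≤r {xs = []} e<r _ _ cover with cover (next< e<r)
  ... | here next≡e = ⊥-elim (NextRow-irrefl 2≤r (subst (NextRow r _) next≡e (NextRow-next e<r)))
  cycle-Hamiltonian-path-last 2≤r {xs = y ∷ ys} e<r u (fwd e→y ∷ l) cover =
    false , oriented-path-last NextRow-functional NextRow-injective e→y l u
              (cover (prev< e<r)) (NextRow-prev e<r) (Unique[x∷xs]⇒x∉xs u)
  cycle-Hamiltonian-path-last 2≤r {xs = y ∷ ys} e<r u (bwd y→e ∷ l) cover =
    true , oriented-path-last {R = flip (NextRow r)} NextRow-injective NextRow-functional y→e
             (Linked.map flip-SymClosure l) u (cover (next< e<r)) (NextRow-next e<r) (Unique[x∷xs]⇒x∉xs u)

-- In column 1 of a Form 1 GG path the rows 0, …, b-1 left free by the prefix are entered from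
-- row r-1, so they can only be climbed upwards.
arc-path-last : ∀ {r b ys} → suc b < r → Unique (r ∸ 1 ∷ ys) → Linked (SymClosure (NextRow r)) (r ∸ 1 ∷ ys) →
  (∀ {i} → i ∈ ys → i < b) → (∀ {i} → i < b → i ∈ ys) → last (r ∸ 1 ∷ ys) ≡ just (prev r b)
arc-path-last {b = zero}  {[]} _ _ _ _ _        = refl
arc-path-last {b = suc b} {[]} _ _ _ _ complete with complete (s≤s z≤n)
... | ()
arc-path-last {suc r} {ys = _ ∷ _} sb<r u (fwd (inj₁ (lt , _)) ∷ _) _ _ = ⊥-elim (<-irrefl refl lt)
arc-path-last {suc r} {b} {_ ∷ ys} sb<r u (fwd (inj₂ (_ , refl)) ∷ l) bounded complete with bounded (here refl)
... | s≤s _ = oriented-path-last NextRow-functional NextRow-injective (inj₂ (refl , refl)) l u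
              (there (complete ≤-refl)) (inj₁ (<⇒≤ sb<r , refl)) (λ b∈ → <-irrefl refl (bounded b∈))
arc-path-last {suc r} {b} sb<r _ (bwd (inj₁ (_ , refl)) ∷ _) bounded _ =
  ⊥-elim (<-irrefl refl (<-≤-trans (bounded (here refl)) (≤-pred (≤-pred sb<r))))
arc-path-last {suc r} sb<r _ (bwd (inj₂ (_ , refl)) ∷ _) _ _ with sb<r
... | s≤s ()

ascending : ℕ → ℕ → List ℕ
ascending s = applyUpTo (s +_)

descending : ℕ → ℕ → List ℕ
descending s = applyDownFrom (s +_)

∈-ascending⁺ : ∀ {s n i} → s ≤ i → i < s + n → i ∈ ascending s n
∈-ascending⁺ {s} {n} {i} s≤i i<s+n =
  subst (_∈ ascending s n) (m+[n∸m]≡n s≤i)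
    (∈-applyUpTo⁺ (s +_) (m≤n<m+o⇒n∸m<o s≤i i<s+n))

∈-ascending⁻ : ∀ {s n i} → i ∈ ascending s n → s ≤ i × i < s + n
∈-ascending⁻ {s} i∈ with ∈-applyUpTo⁻ (s +_) i∈
... | t , t<n , refl = m≤m+n s t , +-monoʳ-< s t<n

∈-descending⁺ : ∀ {s n i} → s ≤ i → i < s + n → i ∈ descending s n
∈-descending⁺ {s} {n} {i} s≤i i<s+n =
  subst (_∈ descending s n) (m+[n∸m]≡n s≤i)
    (∈-applyDownFrom⁺ (s +_) (m≤n<m+o⇒n∸m<o s≤i i<s+n))

∈-descending⁻ : ∀ {s n i} → i ∈ descending s n → s ≤ i × i < s + n
∈-descending⁻ {s} i∈ with ∈-applyDownFrom⁻ (s +_) i∈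
... | t , t<n , refl = m≤m+n s t , +-monoʳ-< s t<n

ascending-Unique : ∀ s n → Unique (ascending s n)
ascending-Unique s n = Uniqueₚ.applyUpTo⁺₁ (s +_) n (λ i<j _ → <⇒≢ (+-monoʳ-< s i<j))

descending-Unique : ∀ s n → Unique (descending s n)
descending-Unique s n = Uniqueₚ.applyDownFrom⁺₁ (s +_) n (λ j<i _ e → <⇒≢ (+-monoʳ-< s j<i) (sym e))

module _ {r : ℕ} where

  private
    NextRow-+ : ∀ s {i} → s + suc i < r → NextRow r (s + i) (s + suc i)
    NextRow-+ s {i} lt = inj₁ (subst (_< r) (+-suc s i) lt , +-suc s i)

  ascending-Linked : ∀ s n → s + n ≤ r → Linked (NextRow r) (ascending s n)
  ascending-Linked s n s+n≤r =
    Linkedₚ.applyUpTo⁺₁ (s +_) n (λ si<n → NextRow-+ s (<-≤-trans (+-monoʳ-< s si<n) s+n≤r))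

  descending-Linked : ∀ s n → s + n ≤ r → Linked (flip (NextRow r)) (descending s n)
  descending-Linked s n s+n≤r =
    Linkedₚ.applyDownFrom⁺₁ (s +_) n (λ si<n → NextRow-+ s (<-≤-trans (+-monoʳ-< s si<n) s+n≤r))

ascending-last : ∀ s n → last (ascending s (suc n)) ≡ just (s + n)
ascending-last s n = begin
  last (ascending s (suc n))              ≡⟨ cong last (sym (applyUpTo-∷ʳ (s +_) n)) ⟩
  last (ascending s n ++ (s + n) ∷ [])    ≡⟨ last-++ʳ (ascending s n) ⟩
  just (s + n)                            ∎
  where open ≡-Reasoning

descending-last : ∀ s n → last (descending s (suc n)) ≡ just s
descending-last s n = begin
  last (descending s (suc n))                           ≡⟨ cong last (sym (applyDownFrom-∷ʳ (s +_) n)) ⟩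
  last (applyDownFrom ((s +_) ∘ suc) n ++ (s + 0) ∷ []) ≡⟨ last-++ʳ (applyDownFrom ((s +_) ∘ suc) n) ⟩
  just (s + 0)                                          ≡⟨ cong just (+-identityʳ s) ⟩
  just s                                                ∎
  where open ≡-Reasoning

-- Paths inside columns

col : ℕ → List ℕ → List Vertex
col j = map (_, j)

InColumn : ℕ → List Vertex → Set
InColumn j = All (λ v → proj₂ v ≡ j)

InColumn⇒col : ∀ {j s} → InColumn j s → ∃ λ xs → s ≡ col j xs
InColumn⇒col [] = [] , refl
InColumn⇒col {s = (i , _) ∷ _} (refl ∷ cs) with InColumn⇒col cs
... | xs , refl = i ∷ xs , refl

∈-col⁺ : ∀ {i j xs} → i ∈ xs → (i , j) ∈ col j xs
∈-col⁺ = ∈-map⁺ _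

∈-col⁻ : ∀ {v j xs} → v ∈ col j xs → proj₂ v ≡ j × proj₁ v ∈ xs
∈-col⁻ v∈ with ∈-map⁻ _ v∈
... | _ , i∈ , refl = refl , i∈

col-Unique⁺ : ∀ {j xs} → Unique xs → Unique (col j xs)
col-Unique⁺ = Uniqueₚ.map⁺ (cong proj₁)

col-last : ∀ {i} j xs → last xs ≡ just i → last (col j xs) ≡ just (i , j)
col-last j xs e = trans (last-map _ xs) (cong (Maybe.map (_, j)) e)

module _ {r c : ℕ} where

  Adj-rightward : ∀ {e i j} → Adj r c (e , j) (i , suc j) → i ≡ e
  Adj-rightward (_ , _ , inj₁ (e≡i , _)) = sym e≡i
  Adj-rightward (_ , _ , inj₂ (j≡sj , _)) = ⊥-elim (1+n≢n (sym j≡sj))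

  Adj-horizontal : ∀ {i j j′} → i < r → j < c → j′ < c → j′ ≡ suc j ⊎ j ≡ suc j′ → Adj r c (i , j) (i , j′)
  Adj-horizontal i<r j<c j′<c h = (i<r , j<c) , (i<r , j′<c) , inj₁ (refl , h)

  Adj-vertical⁺ : ∀ {i i′ j} → j < c → SymClosure (NextRow r) i i′ → Adj r c (i , j) (i′ , j)
  Adj-vertical⁺ j<c (fwd n) = (NextRow⇒<ˡ n , j<c) , (NextRow⇒<ʳ n , j<c) , inj₂ (refl , inj₁ n)
  Adj-vertical⁺ j<c (bwd n) = (NextRow⇒<ʳ n , j<c) , (NextRow⇒<ˡ n , j<c) , inj₂ (refl , inj₂ n)

  Adj-vertical⁻ : ∀ {i i′ j} → Adj r c (i , j) (i′ , j) → SymClosure (NextRow r) i i′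
  Adj-vertical⁻ (_ , _ , inj₁ (_ , inj₁ j≡sj)) = ⊥-elim (1+n≢n (sym j≡sj))
  Adj-vertical⁻ (_ , _ , inj₁ (_ , inj₂ j≡sj)) = ⊥-elim (1+n≢n (sym j≡sj))
  Adj-vertical⁻ (_ , _ , inj₂ (_ , inj₁ n))    = fwd n
  Adj-vertical⁻ (_ , _ , inj₂ (_ , inj₂ n))    = bwd n

  col-Linked⁺ : ∀ {j xs} → j < c → Linked (SymClosure (NextRow r)) xs → Linked (Adj r c) (col j xs)
  col-Linked⁺ j<c l = Linkedₚ.map⁺ (Linked.map (Adj-vertical⁺ j<c) l)

  col-Linked⁻ : ∀ {j xs} → Linked (Adj r c) (col j xs) → Linked (SymClosure (NextRow r)) xs
  col-Linked⁻ l = Linked.map Adj-vertical⁻ (Linkedₚ.map⁻ l)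

  column-traversal-last : 2 ≤ r → ∀ {e j s} → e < r → InColumn (suc j) s → Unique s →
    Linked (Adj r c) ((e , j) ∷ s) → (∀ {i} → i < r → (i , suc j) ∈ s) →
    ∃ λ b → last ((e , j) ∷ s) ≡ just (step r b e , suc j)
  column-traversal-last 2≤r {e} {j} e<r cs u l cover with InColumn⇒col cs
  ... | [] , refl with cover e<r
  ...   | ()
  column-traversal-last 2≤r {e} {j} e<r cs u (a ∷ l) cover | i ∷ xs , refl with Adj-rightward a
  ... | refl with cycle-Hamiltonian-path-last 2≤r e<r (Uniqueₚ.map⁻ u) (col-Linked⁻ l) (λ i<r → proj₂ (∈-col⁻ (cover i<r)))
  ...   | b , last≡ = b , col-last (suc j) (e ∷ xs) last≡

ColumnsFrom : ℕ → List (List Vertex) → Set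
ColumnsFrom j []       = ⊤
ColumnsFrom j (s ∷ ss) = InColumn j s × ColumnsFrom (suc j) ss

ColumnsFrom⇒≤ : ∀ {j ss v} → ColumnsFrom j ss → v ∈ concat ss → j ≤ proj₂ v
ColumnsFrom⇒≤ {ss = s ∷ _} (cs , css) v∈ with ∈-++⁻ s v∈
... | inj₁ v∈s  = ≤-reflexive (sym (All-lookup cs v∈s))
... | inj₂ v∈ss = <⇒≤ (ColumnsFrom⇒≤ css v∈ss)

module _ {r c : ℕ} where

  columns-last : 2 ≤ r → ∀ ss {j e} → e < r → ColumnsFrom (suc j) ss →
    (∀ {i j′} → i < r → j < j′ → j′ ≤ j + length ss → (i , j′) ∈ concat ss) →
    Unique (concat ss) → Linked (Adj r c) ((e , j) ∷ concat ss) →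
    ∃ λ bs → length bs ≡ length ss × last ((e , j) ∷ concat ss) ≡ just (walk r e bs , j + length ss)
  columns-last 2≤r [] {j} {e} _ _ _ _ _ = [] , refl , cong (λ j′ → just (e , j′)) (sym (+-identityʳ j))
  columns-last 2≤r (s ∷ ss) {j} {e} e<r (cs , css) cover u l =
    let b , last-s = column-traversal-last 2≤r e<r cs (Unique-++⁻ˡ s u) (Linked-++⁻ˡ (_ ∷ s) l) cover-s
        bs , len , last≡ = columns-last 2≤r ss (step< b e<r) css cover-ss (Unique-++⁻ʳ s u)
                             (Linked-++⁻ʳ (_ ∷ s) l last-s)
    in b ∷ bs , cong suc len ,
       trans (last-++ (_ ∷ s) last-s)
         (trans last≡ (cong (λ j′ → just (walk r (step r b e) bs , j′)) (sym (+-suc j (length ss)))))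
    where
    cover-s : ∀ {i} → i < r → (i , suc j) ∈ s
    cover-s i<r with ∈-++⁻ s (cover i<r ≤-refl (subst (suc j ≤_) (sym (+-suc j (length ss))) (s≤s (m≤m+n j _))))
    ... | inj₁ ∈s  = ∈s
    ... | inj₂ ∈ss = ⊥-elim (<-irrefl refl (ColumnsFrom⇒≤ css ∈ss))
    cover-ss : ∀ {i j′} → i < r → suc j < j′ → j′ ≤ suc j + length ss → (i , j′) ∈ concat ss
    cover-ss {j′ = j′} i<r sj<j′ j′≤
      with ∈-++⁻ s (cover i<r (<-trans (n<1+n j) sj<j′) (subst (j′ ≤_) (sym (+-suc j (length ss))) j′≤))
    ... | inj₁ ∈s  = ⊥-elim (<-irrefl (sym (All-lookup cs ∈s)) sj<j′)
    ... | inj₂ ∈ss = ∈ss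

col-InColumn : ∀ j xs → InColumn j (col j xs)
col-InColumn j xs = tabulate (λ v∈ → proj₁ (∈-col⁻ v∈))

ColumnsFrom⇒lookup : ∀ {j n} (segs : Vec (List Vertex) n) → ColumnsFrom j (toList segs) →
  ∀ i → InColumn (j + toℕ i) (lookup segs i)
ColumnsFrom⇒lookup {j} (s ∷ _)    (cs , _)  fzero    = subst (λ x → InColumn x s) (sym (+-identityʳ j)) cs
ColumnsFrom⇒lookup {j} (_ ∷ segs) (_ , css) (fsuc i) =
  subst (λ x → InColumn x (lookup segs i)) (sym (+-suc j (toℕ i))) (ColumnsFrom⇒lookup segs css i)

lookup⇒ColumnsFrom : ∀ {j n} (segs : Vec (List Vertex) n) → (∀ i → InColumn (j + toℕ i) (lookup segs i)) →
  ColumnsFrom j (toList segs)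
lookup⇒ColumnsFrom     []         _ = tt
lookup⇒ColumnsFrom {j} (s ∷ segs) h =
  subst (λ x → InColumn x s) (+-identityʳ j) (h fzero) ,
  lookup⇒ColumnsFrom segs (λ i → subst (λ x → InColumn x (lookup segs i)) (+-suc j (toℕ i)) (h (fsuc i)))

-- The prefix of a GG path

isEven-double : ∀ k → isEven (2 * k) ≡ true
isEven-double zero    = refl
isEven-double (suc k) = begin
  isEven (suc k + (suc k + 0))     ≡⟨ cong (λ n → isEven (suc n)) (+-suc k (k + 0)) ⟩
  not (not (isEven (k + (k + 0)))) ≡⟨ not-involutive _ ⟩
  isEven (2 * k)                   ≡⟨ isEven-double k ⟩
  true                             ∎
  where open ≡-Reasoning

zigzag : ℕ → ℕ → List Vertex
zigzag b n = concatMap (zigzagPair b) (upTo n)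

prefix : ℕ → ℕ → List Vertex
prefix b n = col 0 (upTo b) ++ zigzag b n

∈-zigzagPair⁻ : ∀ {b t v} → v ∈ zigzagPair b t → proj₁ v ≡ b + t × proj₂ v ≤ 1
∈-zigzagPair⁻ {t = t} v∈ with isEven t | v∈
... | true  | here refl         = refl , z≤n
... | true  | there (here refl) = refl , ≤-refl
... | false | here refl         = refl , ≤-refl
... | false | there (here refl) = refl , z≤n

∈-zigzagPair⁺ : ∀ {b t j} → j ≤ 1 → (b + t , j) ∈ zigzagPair b t
∈-zigzagPair⁺ {t = t} j≤1 with isEven t | j≤1
... | true  | z≤n     = here refl
... | true  | s≤s z≤n = there (here refl)
... | false | z≤n     = there (here refl)
... | false | s≤s z≤n = here refl

zigzagPair-Unique : ∀ b t → Unique (zigzagPair b t)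
zigzagPair-Unique b t with isEven t
... | true  = ((λ ()) ∷ []) ∷ [] ∷ []
... | false = ((λ ()) ∷ []) ∷ [] ∷ []

last-++-zigzagPair : ∀ xs b t → last (xs ++ zigzagPair b t) ≡ last (zigzagPair b t)
last-++-zigzagPair xs b t with isEven t
... | true  = last-++ʳ xs
... | false = last-++ʳ xs

zigzag-suc : ∀ b n → zigzag b (suc n) ≡ zigzag b n ++ zigzagPair b n
zigzag-suc b n = begin
  concatMap (zigzagPair b) (upTo (suc n))                         ≡⟨ cong (concatMap (zigzagPair b)) (sym (upTo-∷ʳ n)) ⟩
  concat (map (zigzagPair b) (upTo n ++ n ∷ []))                  ≡⟨ cong concat (map-++ (zigzagPair b) (upTo n) (n ∷ [])) ⟩
  concat (map (zigzagPair b) (upTo n) ++ zigzagPair b n ∷ [])     ≡⟨ sym (concat-++ (map (zigzagPair b) (upTo n)) _) ⟩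
  zigzag b n ++ zigzagPair b n ++ []                              ≡⟨ cong (zigzag b n ++_) (++-identityʳ _) ⟩
  zigzag b n ++ zigzagPair b n                                    ∎
  where open ≡-Reasoning

∈-zigzag⁻ : ∀ {b n v} → v ∈ zigzag b n → ∃ λ t → t < n × proj₁ v ≡ b + t × proj₂ v ≤ 1
∈-zigzag⁻ {b} {n} v∈ with find (∈-concatMap⁻ (zigzagPair b) {xs = upTo n} v∈)
... | t , t∈ , v∈pair = t , ∈-upTo⁻ t∈ , ∈-zigzagPair⁻ {b} {t} v∈pair

∈-zigzag⁺ : ∀ {b n t j} → t < n → j ≤ 1 → (b + t , j) ∈ zigzag b n
∈-zigzag⁺ {b} {n} {t} {j} t<n j≤1 =
  ∈-concatMap⁺ (zigzagPair b) {xs = upTo n}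
    (lose {P = λ t′ → (b + t , j) ∈ zigzagPair b t′} (∈-upTo⁺ t<n) (∈-zigzagPair⁺ {b} {t} j≤1))

zigzag-Unique : ∀ b n → Unique (zigzag b n)
zigzag-Unique b zero    = []
zigzag-Unique b (suc n) rewrite zigzag-suc b n =
  Uniqueₚ.++⁺ (zigzag-Unique b n) (zigzagPair-Unique b n) disjoint
  where
  disjoint : ∀ {v} → ¬ (v ∈ zigzag b n × v ∈ zigzagPair b n)
  disjoint (v∈z , v∈p) with ∈-zigzag⁻ {b} v∈z | ∈-zigzagPair⁻ {b} v∈p
  ... | t , t<n , e , _ | e′ , _ = <-irrefl (+-cancelˡ-≡ b _ _ (trans (sym e) e′)) t<n

zigzag-last : ∀ b K → isEven K ≡ true → last (zigzag b (suc K)) ≡ just (b + K , 1)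
zigzag-last b K even = begin
  last (zigzag b (suc K))             ≡⟨ cong last (zigzag-suc b K) ⟩
  last (zigzag b K ++ zigzagPair b K) ≡⟨ last-++-zigzagPair (zigzag b K) b K ⟩
  last (zigzagPair b K)               ≡⟨ cong (λ e → last (if e then (b + K , 0) ∷ (b + K , 1) ∷ []
                                                                else (b + K , 1) ∷ (b + K , 0) ∷ [])) even ⟩
  just (b + K , 1)                    ∎
  where open ≡-Reasoning

module _ {r c : ℕ} (2≤c : 2 ≤ c) where

  private
    0<c : 0 < c
    0<c = <-trans z<s 2≤c

  zigzagPair-Linked : ∀ b t → b + t < r → Linked (Adj r c) (zigzagPair b t)
  zigzagPair-Linked b t lt with isEven t
  ... | true  = Adj-horizontal lt 0<c 2≤c (inj₁ refl) ∷ [-]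
  ... | false = Adj-horizontal lt 2≤c 0<c (inj₂ refl) ∷ [-]

  zigzagPair-continue : ∀ b t → b + suc t < r →
    ∃ λ a → last (zigzagPair b t) ≡ just a × Linked (Adj r c) (a ∷ zigzagPair b (suc t))
  zigzagPair-continue b t lt with isEven t
  ... | true  = _ , refl , Adj-vertical⁺ 2≤c down ∷ Adj-horizontal lt 2≤c 0<c (inj₂ refl) ∷ [-]
    where down = fwd (inj₁ (subst (_< r) (+-suc b t) lt , +-suc b t))
  ... | false = _ , refl , Adj-vertical⁺ 0<c down ∷ Adj-horizontal lt 0<c 2≤c (inj₁ refl) ∷ [-]
    where down = fwd (inj₁ (subst (_< r) (+-suc b t) lt , +-suc b t))

  zigzag-Linked : ∀ b n → b + n ≤ r → Linked (Adj r c) (zigzag b n)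
  zigzag-Linked b zero          _  = []
  zigzag-Linked b (suc zero)    le = zigzagPair-Linked b 0 (subst (_≤ r) (+-suc b 0) le)
  zigzag-Linked b (suc (suc n)) le =
    let a , last≡a , linked-a = zigzagPair-continue b n (subst (_≤ r) (+-suc b (suc n)) le)
    in subst (Linked (Adj r c)) (sym (zigzag-suc b (suc n)))
         (Linked-++⁺ (zigzag b (suc n)) (zigzag-Linked b (suc n) (≤-trans (+-monoʳ-≤ b (n≤1+n _)) le))
           (trans (cong last (zigzag-suc b n)) (trans (last-++-zigzagPair (zigzag b n) b n) last≡a)) linked-a)

∈-prefix⁻ : ∀ {b n v} → v ∈ prefix b n → proj₁ v < b + n × proj₂ v ≤ 1 × (proj₂ v ≡ 1 → b ≤ proj₁ v)
∈-prefix⁻ {b} {n} {i , j} v∈ with ∈-++⁻ (col 0 (upTo b)) v∈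
... | inj₁ v∈col with ∈-col⁻ {i , j} v∈col
...   | refl , i∈ = <-≤-trans (∈-upTo⁻ i∈) (m≤m+n b n) , z≤n , λ ()
∈-prefix⁻ {b} {n} v∈ | inj₂ v∈z with ∈-zigzag⁻ {b} {n} v∈z
... | t , t<n , refl , j≤1 = +-monoʳ-< b t<n , j≤1 , λ _ → m≤m+n b t

∈-prefix⁺ : ∀ {b n i j} → i < b + n → j ≤ 1 → (j ≡ 1 → b ≤ i) → (i , j) ∈ prefix b n
∈-prefix⁺ {b} {n} {i} {j} i<b+n j≤1 col1⇒b≤i with i <? b | j≤1
... | yes i<b | z≤n     = ∈-++⁺ˡ (∈-col⁺ (∈-upTo⁺ i<b))
... | yes i<b | s≤s z≤n = ⊥-elim (<-irrefl refl (<-≤-trans i<b (col1⇒b≤i refl)))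
... | no  i≮b | _       = ∈-++⁺ʳ (col 0 (upTo b))
  (subst (λ x → (x , j) ∈ zigzag b n) (m+[n∸m]≡n (≮⇒≥ i≮b))
    (∈-zigzag⁺ (m≤n<m+o⇒n∸m<o (≮⇒≥ i≮b) i<b+n) j≤1))

prefix-Unique : ∀ b n → Unique (prefix b n)
prefix-Unique b n = Uniqueₚ.++⁺ (col-Unique⁺ (Uniqueₚ.upTo⁺ b)) (zigzag-Unique b n) disjoint
  where
  disjoint : ∀ {v} → ¬ (v ∈ col 0 (upTo b) × v ∈ zigzag b n)
  disjoint (v∈col , v∈z) with ∈-zigzag⁻ {b} {n} v∈z
  ... | t , _ , e , _ = <-irrefl refl (<-≤-trans (∈-upTo⁻ (proj₂ (∈-col⁻ v∈col))) (subst (b ≤_) (sym e) (m≤m+n b t)))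

prefix-last : ∀ b K → isEven K ≡ true → last (prefix b (suc K)) ≡ just (b + K , 1)
prefix-last b K even = trans (last-++ʳ (col 0 (upTo b))) (zigzag-last b K even)

module _ {r c : ℕ} (2≤c : 2 ≤ c) where

  private
    0<c : 0 < c
    0<c = <-trans z<s 2≤c

  prefix-Valid : ∀ {b n} → b + n ≤ r → All (Valid r c) (prefix b n)
  prefix-Valid {b} {n} le = tabulate λ v∈ →
    let lt , j≤1 , _ = ∈-prefix⁻ {b} {n} v∈ in <-≤-trans lt le , <-≤-trans (s≤s j≤1) 2≤c

  prefix-Linked : ∀ b n → b + n ≤ r → Linked (Adj r c) (prefix b n)
  prefix-Linked zero    n le = zigzag-Linked 2≤c 0 n le
  prefix-Linked (suc b) n le =
    Linked-++⁺ (col 0 (upTo (suc b)))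
      (col-Linked⁺ 0<c (Linked.map fwd (ascending-Linked 0 (suc b) (≤-trans (m≤m+n (suc b) n) le))))
      (col-last 0 (upTo (suc b)) (ascending-last 0 b)) (continue n le)
    where
    continue : ∀ n → suc b + n ≤ r → Linked (Adj r c) ((b , 0) ∷ zigzag (suc b) n)
    continue zero    _  = [-]
    continue (suc n) le =
      Adj-vertical⁺ 0<c (fwd (inj₁ (<-≤-trans (s≤s (s≤s (m≤m+n b n))) (subst (_≤ r) (+-suc (suc b) n) le) ,
                                    +-identityʳ (suc b))))
      ∷ zigzag-Linked 2≤c (suc b) (suc n) le

module _ {r : ℕ} (k : ℕ) (2k+1≤r : 2 * k + 1 ≤ r) where

  prefix1≡prefix : prefix1 r k ≡ prefix (r ∸ (2 * k + 1)) (suc (2 * k))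
  prefix1≡prefix = cong (prefix (r ∸ (2 * k + 1))) (+-comm (2 * k) 1)

  r≡suc[b+2k] : r ≡ suc (r ∸ (2 * k + 1) + 2 * k)
  r≡suc[b+2k] = sym (trans (sym (+-suc (r ∸ (2 * k + 1)) (2 * k)))
                           (trans (cong (r ∸ (2 * k + 1) +_) (+-comm 1 (2 * k))) (m∸n+n≡m 2k+1≤r)))

  prefix1-last : last (prefix1 r k) ≡ just (r ∸ 1 , 1)
  prefix1-last = begin
    last (prefix1 r k)                                 ≡⟨ cong last prefix1≡prefix ⟩
    last (prefix (r ∸ (2 * k + 1)) (suc (2 * k)))      ≡⟨ prefix-last (r ∸ (2 * k + 1)) (2 * k) (isEven-double k) ⟩
    just (r ∸ (2 * k + 1) + 2 * k , 1)                 ≡⟨ cong (λ x → just (x ∸ 1 , 1)) (sym r≡suc[b+2k]) ⟩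
    just (r ∸ 1 , 1)                                   ∎
    where open ≡-Reasoning

-- The last row of a Form 1 GG path

module Form1Analysis {r b K : ℕ} (r≡ : r ≡ suc (b + K)) (even : isEven K ≡ true) (0<K : 0 < K)
  {seg₁ : List Vertex} {ss : List (List Vertex)} (col₁ : InColumn 1 seg₁) (cols : ColumnsFrom 2 ss)
  (ham : HamiltonianPath r (2 + length ss) (prefix b (suc K) ++ seg₁ ++ concat ss)) where

  private
    P = prefix b (suc K)
    R = concat ss
    c = 2 + length ss

    valid = proj₁ ham
    unique = proj₁ (proj₂ ham)
    linked = proj₁ (proj₂ (proj₂ ham))
    cover = proj₂ (proj₂ (proj₂ ham))

    b+K+1≡r : b + suc K ≡ r
    b+K+1≡r = trans (+-suc b K) (sym r≡)

    b<r : b < r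
    b<r = subst (b <_) b+K+1≡r (m<m+n b z<s)

    not-in-P : ∀ {v} → v ∈ P → v ∈ seg₁ ++ R → ⊥
    not-in-P = Unique-++-disjoint P unique

    R-columns≥2 : ∀ {v} → v ∈ R → proj₂ v ≤ 1 → ⊥
    R-columns≥2 v∈R j≤1 = <-irrefl refl (≤-trans (ColumnsFrom⇒≤ cols v∈R) j≤1)

    P-last : last P ≡ just (r ∸ 1 , 1)
    P-last = trans (prefix-last b K even) (cong (λ i → just (i , 1)) (cong (_∸ 1) (sym r≡)))

    sb<r : suc b < r
    sb<r = subst (suc b <_) (sym r≡) (s≤s (subst (_≤ b + K) (+-comm b 1) (+-monoʳ-≤ b 0<K)))

  prefix-seg₁-last : last (P ++ seg₁) ≡ just (prev r b , 1)
  prefix-seg₁-last with InColumn⇒col col₁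
  ... | ys , refl = begin
    last (P ++ col 1 ys)            ≡⟨ last-++ P P-last ⟩
    last (col 1 (r ∸ 1 ∷ ys))       ≡⟨ col-last 1 (r ∸ 1 ∷ ys) (arc-path-last sb<r ys-unique ys-linked bounded complete) ⟩
    just (prev r b , 1)             ∎
    where
    open ≡-Reasoning
    bounded : ∀ {i} → i ∈ ys → i < b
    bounded {i} i∈ with i <? b
    ... | yes i<b = i<b
    ... | no  i≮b = ⊥-elim (not-in-P (∈-prefix⁺ i<b+K+1 ≤-refl (λ _ → ≮⇒≥ i≮b)) (∈-++⁺ˡ i∈seg₁))
      where
      i∈seg₁ : (i , 1) ∈ col 1 ys
      i∈seg₁ = ∈-col⁺ i∈
      i<b+K+1 : i < b + suc K
      i<b+K+1 = subst (i <_) (sym b+K+1≡r) (proj₁ (All-lookup valid (∈-++⁺ʳ P (∈-++⁺ˡ i∈seg₁))))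
    complete : ∀ {i} → i < b → i ∈ ys
    complete {i} i<b with ∈-++⁻ P (cover (i , 1) (<-trans i<b b<r , s≤s (s≤s z≤n)))
    ... | inj₁ ∈P = ⊥-elim (<-irrefl refl (<-≤-trans i<b (proj₂ (proj₂ (∈-prefix⁻ {b} {suc K} ∈P)) refl)))
    ... | inj₂ ∈rest with ∈-++⁻ (col 1 ys) ∈rest
    ...   | inj₁ ∈seg₁ = proj₂ (∈-col⁻ ∈seg₁)
    ...   | inj₂ ∈R    = ⊥-elim (R-columns≥2 ∈R ≤-refl)
    ys-unique : Unique (r ∸ 1 ∷ ys)
    ys-unique = tabulate (λ i∈ r∸1≡i → <-irrefl refl (<-≤-trans (bounded (subst (_∈ ys) (sym r∸1≡i) i∈))
                                          (subst (b ≤_) (cong (_∸ 1) (sym r≡)) (m≤m+n b K))))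
                ∷ Uniqueₚ.map⁻ (Unique-++⁻ˡ (col 1 ys) (Unique-++⁻ʳ P unique))
    ys-linked : Linked (SymClosure (NextRow r)) (r ∸ 1 ∷ ys)
    ys-linked = col-Linked⁻ {c = c} (Linked-++⁻ˡ (col 1 (r ∸ 1 ∷ ys)) (Linked-++⁻ʳ P linked P-last))

  form1-last : ∃ λ bs → length bs ≡ length ss × last (P ++ seg₁ ++ R) ≡ just (walk r (prev r b) bs , suc (length ss))
  form1-last =
    let bs , len , last≡ = columns-last {c = c} (<-≤-trans (s≤s z<s) sb<r) ss (prev< b<r) cols R-cover
                             (Unique-++⁻ʳ seg₁ (Unique-++⁻ʳ P unique))
                             (Linked-++⁻ʳ (P ++ seg₁) (subst (Linked (Adj r c)) (sym (++-assoc P seg₁ R)) linked)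
                                prefix-seg₁-last)
    in bs , len , trans (cong last (sym (++-assoc P seg₁ R))) (trans (last-++ (P ++ seg₁) prefix-seg₁-last) last≡)
    where
    R-cover : ∀ {i j} → i < r → 1 < j → j ≤ 1 + length ss → (i , j) ∈ R
    R-cover {i} {j} i<r 1<j j≤ with ∈-++⁻ P (cover (i , j) (i<r , s≤s j≤))
    ... | inj₁ ∈P = ⊥-elim (<-irrefl refl (<-≤-trans 1<j (proj₁ (proj₂ (∈-prefix⁻ {b} {suc K} ∈P)))))
    ... | inj₂ ∈rest with ∈-++⁻ seg₁ ∈rest
    ...   | inj₁ ∈seg₁ = ⊥-elim (<-irrefl (sym (All-lookup col₁ ∈seg₁)) 1<j)
    ...   | inj₂ ∈R    = ∈R

-- Constructing Form 1 GG paths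

traversal : ℕ → Bool → ℕ → List ℕ
traversal r false e = ascending e (r ∸ e) ++ upTo e
traversal r true  e = downFrom (suc e) ++ descending (suc e) (r ∸ suc e)

last-++-upTo : ∀ {r a} xs e → last xs ≡ just a → suc a ≡ r → last (xs ++ upTo e) ≡ just (prev r e)
last-++-upTo xs zero    last≡ refl = trans (cong last (++-identityʳ xs)) last≡
last-++-upTo xs (suc e) _     _    = trans (last-++ʳ xs) (ascending-last 0 e)

module _ {r e : ℕ} (e<r : e < r) where

  ∈-traversal⁺ : ∀ b {i} → i < r → i ∈ traversal r b e
  ∈-traversal⁺ false {i} i<r with i <? e
  ... | yes i<e = ∈-++⁺ʳ (ascending e (r ∸ e)) (∈-upTo⁺ i<e)
  ... | no  i≮e = ∈-++⁺ˡ (∈-ascending⁺ (≮⇒≥ i≮e) (subst (i <_) (sym (m+[n∸m]≡n (<⇒≤ e<r))) i<r))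
  ∈-traversal⁺ true {i} i<r with i <? suc e
  ... | yes i≤e = ∈-++⁺ˡ (∈-downFrom⁺ i≤e)
  ... | no  i≰e = ∈-++⁺ʳ (downFrom (suc e)) (∈-descending⁺ (≮⇒≥ i≰e) (subst (i <_) (sym (m+[n∸m]≡n e<r)) i<r))

  ∈-traversal⁻ : ∀ b {i} → i ∈ traversal r b e → i < r
  ∈-traversal⁻ false i∈ with ∈-++⁻ (ascending e (r ∸ e)) i∈
  ... | inj₁ i∈asc = subst (_ <_) (m+[n∸m]≡n (<⇒≤ e<r)) (proj₂ (∈-ascending⁻ i∈asc))
  ... | inj₂ i∈up  = <-trans (∈-upTo⁻ i∈up) e<r
  ∈-traversal⁻ true i∈ with ∈-++⁻ (downFrom (suc e)) i∈
  ... | inj₁ i∈down = <-≤-trans (∈-downFrom⁻ i∈down) e<r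
  ... | inj₂ i∈desc = subst (_ <_) (m+[n∸m]≡n e<r) (proj₂ (∈-descending⁻ i∈desc))

  traversal-Unique : ∀ b → Unique (traversal r b e)
  traversal-Unique false = Uniqueₚ.++⁺ (ascending-Unique e _) (Uniqueₚ.upTo⁺ e)
    λ (i∈asc , i∈up) → <-irrefl refl (<-≤-trans (∈-upTo⁻ i∈up) (proj₁ (∈-ascending⁻ i∈asc)))
  traversal-Unique true = Uniqueₚ.++⁺ (Uniqueₚ.downFrom⁺ (suc e)) (descending-Unique (suc e) _)
    λ (i∈down , i∈desc) → <-irrefl refl (<-≤-trans (∈-downFrom⁻ i∈down) (proj₁ (∈-descending⁻ i∈desc)))

  traversal-head : ∀ b → ∃ λ t → traversal r b e ≡ e ∷ t
  traversal-head false with r ∸ e in eq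
  ... | zero  = ⊥-elim (<-irrefl (sym eq) (m<n⇒0<n∸m e<r))
  ... | suc m = _ , cong (_∷ applyUpTo ((e +_) ∘ suc) m ++ upTo e) (+-identityʳ e)
  traversal-head true = _ , refl

  traversal-Linked : ∀ b → Linked (SymClosure (NextRow r)) (traversal r b e)
  traversal-Linked false with r ∸ e in eq
  ... | zero  = ⊥-elim (<-irrefl (sym eq) (m<n⇒0<n∸m e<r))
  ... | suc m =
    Linked-++⁺ (ascending e (suc m))
      (Linked.map fwd (ascending-Linked e (suc m) (≤-reflexive (trans (+-suc e m) (∸≡suc⇒ (<⇒≤ e<r) eq)))))
      (ascending-last e m) (wrap-around e (<⇒≤ e<r))
    where
    wrap-around : ∀ e′ → e′ ≤ r → Linked (SymClosure (NextRow r)) (e + m ∷ upTo e′)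
    wrap-around zero     _    = [-]
    wrap-around (suc e′) e′<r =
      fwd (inj₂ (∸≡suc⇒ (<⇒≤ e<r) eq , refl)) ∷ Linked.map fwd (ascending-Linked 0 (suc e′) e′<r)
  traversal-Linked true with r ∸ suc e in eq
  ... | zero  = Linked-++⁺ (downFrom (suc e)) down (descending-last 0 e) [-]
    where down = Linked.map bwd (descending-Linked 0 (suc e) e<r)
  ... | suc m =
    Linked-++⁺ (downFrom (suc e)) (Linked.map bwd (descending-Linked 0 (suc e) e<r))
      (descending-last 0 e)
      (bwd (inj₂ (∸≡suc⇒ e<r eq , refl))
        ∷ Linked.map bwd (descending-Linked (suc e) (suc m) (≤-reflexive (trans (+-suc (suc e) m) (∸≡suc⇒ e<r eq)))))

  traversal-last : ∀ b → last (traversal r b e) ≡ just (step r b e)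
  traversal-last false with r ∸ e in eq
  ... | zero  = ⊥-elim (<-irrefl (sym eq) (m<n⇒0<n∸m e<r))
  ... | suc m = last-++-upTo (ascending e (suc m)) e (ascending-last e m) (∸≡suc⇒ (<⇒≤ e<r) eq)
  traversal-last true with r ∸ suc e in eq
  ... | zero  = trans (cong last (++-identityʳ (downFrom (suc e))))
                  (trans (descending-last 0 e) (cong just (NextRow⇒≡next (inj₂ (≤-antisym e<r (m∸n≡0⇒m≤n eq) , refl)))))
  ... | suc m = trans (last-++ʳ (downFrom (suc e))) (trans (descending-last (suc e) m)
                  (cong just (NextRow⇒≡next
                    (inj₁ (subst (suc (suc e) ≤_) (∸≡suc⇒ e<r eq) (s≤s (s≤s (m≤m+n e m))) , refl)))))

traversals : ℕ → ℕ → ℕ → (bs : List Bool) → Vec (List Vertex) (length bs)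
traversals r j e []       = []
traversals r j e (b ∷ bs) = col j (traversal r b e) ∷ traversals r (suc j) (step r b e) bs

traversed : ℕ → ℕ → ℕ → List Bool → List Vertex
traversed r j e bs = concat (toList (traversals r j e bs))

module _ {r : ℕ} where

  traversals-ColumnsFrom : ∀ j e bs → ColumnsFrom j (toList (traversals r j e bs))
  traversals-ColumnsFrom j e []       = tt
  traversals-ColumnsFrom j e (b ∷ bs) = col-InColumn j (traversal r b e) , traversals-ColumnsFrom (suc j) (step r b e) bs

  ∈-traversed⁻ : ∀ j e bs {v} → e < r → v ∈ traversed r j e bs → proj₂ v < j + length bs × proj₁ v < r
  ∈-traversed⁻ j e (b ∷ bs) {v} e<r v∈ with ∈-++⁻ (col j (traversal r b e)) v∈
  ... | inj₁ v∈col = let j≡ , i∈ = ∈-col⁻ v∈col in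
                     subst (_< j + suc (length bs)) (sym j≡) (m<m+n j z<s) , ∈-traversal⁻ e<r b i∈
  ... | inj₂ v∈rest = let lt , i<r = ∈-traversed⁻ (suc j) (step r b e) bs (step< b e<r) v∈rest in
                      subst (proj₂ v <_) (sym (+-suc j (length bs))) lt , i<r

  ∈-traversed⁺ : ∀ j e bs {i j′} → e < r → i < r → j ≤ j′ → j′ < j + length bs → (i , j′) ∈ traversed r j e bs
  ∈-traversed⁺ j e []       {j′ = j′} _ _ j≤j′ j′< =
    ⊥-elim (<-irrefl refl (≤-<-trans j≤j′ (subst (j′ <_) (+-identityʳ j) j′<)))
  ∈-traversed⁺ j e (b ∷ bs) {j′ = j′} e<r i<r j≤j′ j′< with j ≟ j′
  ... | yes refl = ∈-++⁺ˡ (∈-col⁺ (∈-traversal⁺ e<r b i<r))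
  ... | no  j≢j′ = ∈-++⁺ʳ (col j (traversal r b e))
    (∈-traversed⁺ (suc j) (step r b e) bs (step< b e<r) i<r (≤∧≢⇒< j≤j′ j≢j′)
      (subst (j′ <_) (+-suc j (length bs)) j′<))

  traversed-Unique : ∀ j e bs → e < r → Unique (traversed r j e bs)
  traversed-Unique j e []       _   = []
  traversed-Unique j e (b ∷ bs) e<r =
    Uniqueₚ.++⁺ (col-Unique⁺ (traversal-Unique e<r b)) (traversed-Unique (suc j) (step r b e) bs (step< b e<r))
      λ (v∈col , v∈rest) → <-irrefl (sym (proj₁ (∈-col⁻ v∈col)))
                              (ColumnsFrom⇒≤ (traversals-ColumnsFrom (suc j) (step r b e) bs) v∈rest)

  traversed-Linked : ∀ {c} j e bs → e < r → suc j + length bs ≤ c →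
    Linked (Adj r c) ((e , j) ∷ traversed r (suc j) e bs)
  traversed-Linked j e []       _   _  = [-]
  traversed-Linked {c} j e (b ∷ bs) e<r le
    with traversal r b e | traversal-head e<r b | traversal-Linked e<r b | traversal-last e<r b
  ... | .(e ∷ t) | t , refl | linked | last≡ =
    Adj-horizontal e<r (<-trans (n<1+n j) sj<c) sj<c (inj₁ refl) ∷
    Linked-++⁺ (col (suc j) (e ∷ t)) (col-Linked⁺ sj<c linked) (col-last (suc j) (e ∷ t) last≡)
      (traversed-Linked (suc j) (step r b e) bs (step< b e<r) (subst (_≤ c) (+-suc (suc j) (length bs)) le))
    where
    sj<c : suc j < c
    sj<c = <-≤-trans (m<m+n (suc j) z<s) le

  traversed-last : ∀ j e bs → e < r →
    last ((e , j) ∷ traversed r (suc j) e bs) ≡ just (walk r e bs , j + length bs)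
  traversed-last j e []       _   = cong (λ x → just (e , x)) (sym (+-identityʳ j))
  traversed-last j e (b ∷ bs) e<r with traversal r b e | traversal-head e<r b | traversal-last e<r b
  ... | .(e ∷ t) | t , refl | last≡ =
    trans (last-++ (col (suc j) (e ∷ t)) (col-last (suc j) (e ∷ t) last≡))
      (trans (traversed-last (suc j) (step r b e) bs (step< b e<r))
        (cong (λ x → just (walk r (step r b e) bs , x)) (sym (+-suc j (length bs)))))

module Form1Construction {r k : ℕ} (2k+1≤r : 2 * k + 1 ≤ r) (bs : List Bool) where

  b = r ∸ (2 * k + 1)
  c = 2 + length bs
  rest = col 1 (upTo b) ++ traversed r 2 (prev r b) bs
  path = prefix1 r k ++ rest

  private
    P = prefix1 r k

    b+n≡r : b + (2 * k + 1) ≡ r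
    b+n≡r = m∸n+n≡m 2k+1≤r

    b+n≤r : b + (2 * k + 1) ≤ r
    b+n≤r = ≤-reflexive b+n≡r

    b<r : b < r
    b<r = <-≤-trans (m<m+n b (subst (0 <_) (+-comm 1 (2 * k)) z<s)) b+n≤r

    1<c : 1 < c
    1<c = s≤s (s≤s z≤n)

    suc[r∸1]≡r : suc (r ∸ 1) ≡ r
    suc[r∸1]≡r = trans (cong (λ x → suc (x ∸ 1)) (r≡suc[b+2k] k 2k+1≤r)) (sym (r≡suc[b+2k] k 2k+1≤r))

    rest-Linked : ∀ b′ → b′ < r → Linked (Adj r c) ((r ∸ 1 , 1) ∷ col 1 (upTo b′) ++ traversed r 2 (prev r b′) bs)
    rest-Linked zero     b′<r = traversed-Linked 1 (prev r 0) bs (prev< b′<r) ≤-refl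
    rest-Linked (suc b′) b′<r =
      Adj-vertical⁺ 1<c (fwd (inj₂ (suc[r∸1]≡r , refl))) ∷
      Linked-++⁺ (col 1 (upTo (suc b′))) (col-Linked⁺ 1<c (Linked.map fwd (ascending-Linked 0 (suc b′) (<⇒≤ b′<r))))
        (col-last 1 (upTo (suc b′)) (ascending-last 0 b′)) (traversed-Linked 1 b′ bs (<-trans (n<1+n b′) b′<r) ≤-refl)

    rest-last : ∀ b′ → b′ < r →
      last ((r ∸ 1 , 1) ∷ col 1 (upTo b′) ++ traversed r 2 (prev r b′) bs) ≡ just (walk r (prev r b′) bs , suc (length bs))
    rest-last zero     b′<r = traversed-last 1 (prev r 0) bs (prev< b′<r)
    rest-last (suc b′) b′<r =
      trans (last-++ (col 1 (upTo (suc b′))) (col-last 1 (upTo (suc b′)) (ascending-last 0 b′)))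
        (traversed-last 1 b′ bs (<-trans (n<1+n b′) b′<r))

    valid : All (Valid r c) path
    valid = Allₚ.++⁺ (prefix-Valid 1<c {b} {2 * k + 1} b+n≤r) (Allₚ.++⁺ (tabulate seg₁-valid) (tabulate traversed-valid))
      where
      seg₁-valid : ∀ {v} → v ∈ col 1 (upTo b) → Valid r c v
      seg₁-valid v∈ with ∈-col⁻ v∈
      ... | refl , i∈ = <-trans (∈-upTo⁻ i∈) b<r , 1<c
      traversed-valid : ∀ {v} → v ∈ traversed r 2 (prev r b) bs → Valid r c v
      traversed-valid v∈ = let j< , i<r = ∈-traversed⁻ 2 (prev r b) bs (prev< b<r) v∈ in i<r , j<

    unique : Unique path
    unique = Uniqueₚ.++⁺ (prefix-Unique b (2 * k + 1))
               (Uniqueₚ.++⁺ (col-Unique⁺ (Uniqueₚ.upTo⁺ b)) (traversed-Unique 2 (prev r b) bs (prev< b<r)) seg₁-traversed)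
               prefix-rest
      where
      column≥2 : ∀ {v} → v ∈ traversed r 2 (prev r b) bs → 2 ≤ proj₂ v
      column≥2 = ColumnsFrom⇒≤ (traversals-ColumnsFrom 2 (prev r b) bs)
      seg₁-traversed : ∀ {v} → ¬ (v ∈ col 1 (upTo b) × v ∈ traversed r 2 (prev r b) bs)
      seg₁-traversed (v∈seg₁ , v∈T) = <-irrefl (sym (proj₁ (∈-col⁻ v∈seg₁))) (column≥2 v∈T)
      prefix-rest : ∀ {v} → ¬ (v ∈ P × v ∈ rest)
      prefix-rest {v} (v∈P , v∈rest) with ∈-prefix⁻ {b} {2 * k + 1} v∈P | ∈-++⁻ (col 1 (upTo b)) v∈rest
      ... | _ , _ , col₁⇒b≤i | inj₁ v∈seg₁ =
        let j≡1 , i∈ = ∈-col⁻ v∈seg₁ in <-irrefl refl (<-≤-trans (∈-upTo⁻ i∈) (col₁⇒b≤i j≡1))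
      ... | _ , j≤1 , _ | inj₂ v∈T = <-irrefl refl (≤-<-trans j≤1 (column≥2 v∈T))

    cover : ∀ v → Valid r c v → v ∈ path
    cover (i , zero) (i<r , _) = ∈-++⁺ˡ (∈-prefix⁺ {b} {2 * k + 1} (<-≤-trans i<r (≤-reflexive (sym b+n≡r))) z≤n λ ())
    cover (i , suc zero) (i<r , _) with i <? b
    ... | yes i<b = ∈-++⁺ʳ P (∈-++⁺ˡ (∈-col⁺ (∈-upTo⁺ i<b)))
    ... | no  i≮b = ∈-++⁺ˡ (∈-prefix⁺ {b} {2 * k + 1} (<-≤-trans i<r (≤-reflexive (sym b+n≡r))) ≤-refl (λ _ → ≮⇒≥ i≮b))
    cover (i , suc (suc j)) (i<r , j<c) =
      ∈-++⁺ʳ P (∈-++⁺ʳ (col 1 (upTo b)) (∈-traversed⁺ 2 (prev r b) bs (prev< b<r) i<r (s≤s (s≤s z≤n)) j<c))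

  path-HamiltonianPath : HamiltonianPath r c path
  path-HamiltonianPath =
    valid , unique , Linked-++⁺ P (prefix-Linked 1<c b (2 * k + 1) b+n≤r) (prefix1-last k 2k+1≤r) (rest-Linked b b<r) , cover

  rest-ColumnByColumn : ColumnByColumn c rest
  rest-ColumnByColumn = segs , refl , ColumnsFrom⇒lookup segs (col-InColumn 1 (upTo b) , traversals-ColumnsFrom 2 (prev r b) bs)
    where
    segs = col 1 (upTo b) ∷ traversals r 2 (prev r b) bs

  path-last : last path ≡ just (walk r (prev r b) bs , suc (length bs))
  path-last = trans (last-++ P (prefix1-last k 2k+1≤r)) (rest-last b b<r)

-- Mirroring the rows

neg : ℕ → ℕ → ℕ
neg r zero    = zero
neg r (suc i) = r ∸ suc i

neg< : ∀ {r i} → i < r → neg r i < r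
neg< {r}     {zero}  lt = lt
neg< {suc r} {suc i} _  = s≤s (m∸n≤m r i)

neg-involutive : ∀ {r i} → i < r → neg r (neg r i) ≡ i
neg-involutive {r}     {zero}  _        = refl
neg-involutive {suc r} {suc i} (s≤s lt) = begin
  neg (suc r) (r ∸ i)                ≡⟨ cong (neg (suc r)) (m<n⇒n∸m≡1+n∸1+m lt) ⟩
  neg (suc r) (suc (r ∸ suc i))      ≡⟨ m∸[m∸n]≡n lt ⟩
  suc i                              ∎
  where open ≡-Reasoning

neg-NextRow : ∀ {r i i′} → NextRow r i i′ → NextRow r (neg r i′) (neg r i)
neg-NextRow {suc r} {zero}  (inj₁ (_ , refl))  = inj₂ (refl , refl)
neg-NextRow {suc r} {suc i} (inj₁ (lt , refl)) =
  inj₁ (subst (_< suc r) ∸≡ (s≤s (m∸n≤m r i)) , ∸≡)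
  where
  ∸≡ : r ∸ i ≡ suc (r ∸ suc i)
  ∸≡ = m<n⇒n∸m≡1+n∸1+m (<-trans (n<1+n i) (≤-pred lt))
neg-NextRow {.1}             {zero}  (inj₂ (refl , refl)) = inj₂ (refl , refl)
neg-NextRow {.(suc (suc i))} {suc i} (inj₂ (refl , refl)) =
  inj₁ (s≤s (s≤s z≤n) , trans (m<n⇒n∸m≡1+n∸1+m (n<1+n i)) (cong suc (n∸n≡0 i)))

modN-< : ∀ {r i} → i < r → modN i r ≡ i
modN-< {suc r} = m<n⇒m%n≡m

modN< : ∀ {r} n → 0 < r → modN n r < r
modN< {suc r} n _ = m%n<n n (suc r)

negMod-modN : ∀ {r} n → negMod (modN n r) r ≡ negMod n r
negMod-modN {zero}  n = refl
negMod-modN {suc r} n = cong (λ a → modN (suc r ∸ a) (suc r)) (m%n%n≡m%n n (suc r))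

negMod≡neg : ∀ {r i} → i < r → negMod i r ≡ neg r i
negMod≡neg {suc r} {zero}  _  = n%n≡0 (suc r)
negMod≡neg {suc r} {suc i} lt rewrite modN-< {suc r} lt = m<n⇒m%n≡m (s≤s (m∸n≤m r i))

negMod-involutive : ∀ {r} n → 0 < r → negMod (negMod n r) r ≡ modN n r
negMod-involutive {r} n 0<r = begin
  negMod (negMod n r) r          ≡⟨ cong (λ a → negMod a r) (sym (negMod-modN {r} n)) ⟩
  negMod (negMod (modN n r) r) r ≡⟨ cong (λ a → negMod a r) (negMod≡neg a<r) ⟩
  negMod (neg r (modN n r)) r    ≡⟨ negMod≡neg (neg< a<r) ⟩
  neg r (neg r (modN n r))       ≡⟨ neg-involutive a<r ⟩
  modN n r                       ∎
  where
  open ≡-Reasoning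
  a<r = modN< n 0<r

modN-suc : ∀ {r} n → 2 ≤ r → modN (suc n) r ≡ next r (modN n r)
modN-suc {suc zero}    n (s≤s ())
modN-suc {suc (suc r)} n _ = trans (%-distribˡ-+ 1 n (suc (suc r))) (NextRow⇒≡next next-row)
  where
  a = n % suc (suc r)
  next-row : NextRow (suc (suc r)) a ((1 + a) % suc (suc r))
  next-row with suc a <? suc (suc r)
  ... | yes lt = inj₁ (lt , m<n⇒m%n≡m lt)
  ... | no ¬lt = inj₂ (sa≡r , trans (cong (_% suc (suc r)) sa≡r) (n%n≡0 (suc (suc r))))
    where
    sa≡r : suc a ≡ suc (suc r)
    sa≡r = ≤-antisym (m%n<n n (suc (suc r))) (≮⇒≥ ¬lt)

negMod-suc : ∀ {r} n → 2 ≤ r → negMod (suc n) r ≡ prev r (negMod n r)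
negMod-suc {r} n 2≤r = begin
  negMod (suc n) r                  ≡⟨ sym (negMod-modN {r} (suc n)) ⟩
  negMod (modN (suc n) r) r         ≡⟨ cong (λ a → negMod a r) (modN-suc n 2≤r) ⟩
  negMod (next r a) r               ≡⟨ negMod≡neg (next< a<r) ⟩
  neg r (next r a)                  ≡⟨ NextRow⇒≡prev (neg-NextRow (NextRow-next a<r)) ⟩
  prev r (neg r a)                  ≡⟨ cong (prev r) (sym (negMod≡neg a<r)) ⟩
  prev r (negMod a r)               ≡⟨ cong (prev r) (negMod-modN {r} n) ⟩
  prev r (negMod n r)               ∎
  where
  open ≡-Reasoning
  a = modN n r
  a<r = modN< n (<-trans z<s 2≤r)

∸≡negMod : ∀ {r n} → 0 < n → n ≤ r → r ∸ n ≡ negMod n r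
∸≡negMod {r} {suc n} _ n<r with m≤n⇒m<n∨m≡n n<r
... | inj₁ lt   = sym (negMod≡neg lt)
... | inj₂ refl =
  trans (n∸n≡0 (suc n)) (sym (trans (cong (λ a → modN (suc n ∸ a) (suc n)) (n%n≡0 (suc n))) (n%n≡0 (suc n))))

mirror : ℕ → Vertex → Vertex
mirror r v = negMod (proj₁ v) r , proj₂ v

module _ {r c : ℕ} where

  mirror-Valid : ∀ {v} → Valid r c v → Valid r c (mirror r v)
  mirror-Valid (i<r , j<c) = subst (_< r) (sym (negMod≡neg i<r)) (neg< i<r) , j<c

  mirror-involutive : ∀ {v} → Valid r c v → mirror r (mirror r v) ≡ v
  mirror-involutive {i , j} (i<r , _) = cong (_, j) (trans (negMod-involutive i (≤-<-trans z≤n i<r)) (modN-< i<r))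

  map-mirror-involutive : ∀ {xs} → All (Valid r c) xs → map (mirror r) (map (mirror r) xs) ≡ xs
  map-mirror-involutive []       = refl
  map-mirror-involutive (v ∷ vs) = cong₂ _∷_ (mirror-involutive v) (map-mirror-involutive vs)

  mirror-Adj : ∀ {u v} → Adj r c u v → Adj r c (mirror r u) (mirror r v)
  mirror-Adj {i , j} {i′ , j′} ((i<r , j<c) , (i′<r , j′<c) , edge)
    rewrite negMod≡neg i<r | negMod≡neg i′<r =
    (neg< i<r , j<c) , (neg< i′<r , j′<c) ,
    Sum.map (Product.map₁ (cong (neg r))) (Product.map₂ (Sum.swap ∘ Sum.map neg-NextRow neg-NextRow)) edge

  mirror-HamiltonianPath : ∀ {p} → HamiltonianPath r c p → HamiltonianPath r c (map (mirror r) p)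
  mirror-HamiltonianPath {p} (valid , unique , linked , cover) =
    Allₚ.map⁺ (All.map mirror-Valid valid) ,
    Uniqueₚ.map⁻ (subst Unique (sym (map-mirror-involutive valid)) unique) ,
    Linkedₚ.map⁺ (Linked.map mirror-Adj linked) ,
    λ v v-valid → subst (_∈ map (mirror r) p) (mirror-involutive v-valid)
                    (∈-map⁺ (mirror r) (cover (mirror r v) (mirror-Valid v-valid)))

  mirror-ColumnByColumn : ∀ {rest} → ColumnByColumn c rest → ColumnByColumn c (map (mirror r) rest)
  mirror-ColumnByColumn (segs , refl , columns) =
    Vec.map (map (mirror r)) segs ,
    sym (trans (cong concat (toList-map (map (mirror r)) segs)) (concat-map (toList segs))) ,
    λ j → subst (All _) (sym (lookup-map j (map (mirror r)) segs)) (Allₚ.map⁺ (columns j))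

mirror-prefix2 : ∀ {r} k → 2 * k + 1 ≤ r → map (mirror r) (prefix2 r k) ≡ prefix1 r k
mirror-prefix2 {r} k 2k+1≤r =
  map-mirror-involutive {c = 2} (prefix-Valid ≤-refl {r ∸ (2 * k + 1)} {2 * k + 1} (≤-reflexive (m∸n+n≡m 2k+1≤r)))

-- Rows that are new in A_{r,c,m}

budget-mono : ∀ {k m} n → k ≤ m → 2 * k + 1 + n ≤ 2 * m + suc n
budget-mono {k} {m} n k≤m = subst (_≤ 2 * m + suc n) (sym (+-assoc (2 * k) 1 n)) (+-monoˡ-≤ (suc n) (*-monoʳ-≤ 2 k≤m))

budget-cancel : ∀ {k m} n → 2 * k + 1 + n ≤ 2 * m + suc n → k ≤ m
budget-cancel {k} {m} n le =
  *-cancelˡ-≤ 2 (+-cancelʳ-≤ (suc n) (2 * k) (2 * m) (subst (_≤ 2 * m + suc n) (+-assoc (2 * k) 1 n) le))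

-- For k ≥ 1, exactly the last rows of the Form 1 GG paths with parameter k and n + 2 columns.
Reachable : ℕ → ℕ → ℕ → ℕ → Set
Reachable r n k x = ∃ λ bs → length bs ≡ n × x ≡ walk r (prev r (r ∸ (2 * k + 1))) bs

module _ {r n k x : ℕ} (2k+1≤r : 2 * k + 1 ≤ r) where

  Reachable⇒InA : Reachable r n k x → InA r (2 + n) k x
  Reachable⇒InA (bs , refl , refl) =
    k , path , (2k+1≤r , path-HamiltonianPath , rest , rest-ColumnByColumn , inj₁ refl) , budget-mono {k} (length bs) ≤-refl , path-last
    where open Form1Construction {k = k} 2k+1≤r bs

  Reachable⇒InA-mirror : Reachable r n k x → InA r (2 + n) k (negMod x r)
  Reachable⇒InA-mirror (bs , refl , refl) =
    k , map (mirror r) path ,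
    (2k+1≤r , mirror-HamiltonianPath path-HamiltonianPath , map (mirror r) rest , mirror-ColumnByColumn {r} {c} rest-ColumnByColumn ,
     inj₂ (map-++ (mirror r) (prefix1 r k) rest)) ,
    budget-mono {k} (length bs) ≤-refl , trans (last-map (mirror r) path) (cong (Maybe.map (mirror r)) path-last)
    where open Form1Construction {k = k} 2k+1≤r bs

  form1-Reachable : ∀ {p rest} → 1 ≤ k → HamiltonianPath r (2 + n) p → ColumnByColumn (2 + n) rest →
    p ≡ prefix1 r k ++ rest → last p ≡ just (x , suc n) → Reachable r n k x
  form1-Reachable {p} 1≤k ham (seg₁ ∷ segs , refl , columns) refl last≡
    with lookup⇒ColumnsFrom (seg₁ ∷ segs) columns
  ... | col₁ , cols =
    let bs , len , last≡′ = form1-last {b = r ∸ (2 * k + 1)} {K = 2 * k} (r≡suc[b+2k] k 2k+1≤r) (isEven-double k)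
                              (<-≤-trans z<s (*-monoʳ-≤ 2 1≤k)) col₁ cols
                              (subst₂ (λ m → HamiltonianPath r (2 + m)) (sym (length-toList segs)) p≡ ham)
    in bs , trans len (length-toList segs) , ,-injectiveˡ (just-injective (trans (sym last≡) (trans (cong last p≡) last≡′)))
    where
    open Form1Analysis
    p≡ : p ≡ prefix (r ∸ (2 * k + 1)) (suc (2 * k)) ++ seg₁ ++ concat (toList segs)
    p≡ = cong (_++ seg₁ ++ concat (toList segs)) (prefix1≡prefix k 2k+1≤r)

flipFirst : List Bool → List Bool
flipFirst []           = []
flipFirst (true ∷ bs)  = false ∷ bs
flipFirst (false ∷ bs) = false ∷ flipFirst bs

length-flipFirst : ∀ bs → length (flipFirst bs) ≡ length bs
length-flipFirst []           = refl
length-flipFirst (true ∷ bs)  = refl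
length-flipFirst (false ∷ bs) = cong suc (length-flipFirst bs)

walk-flipFirst : ∀ {r e} bs → true ∈ bs → e < r → walk r (next r (next r e)) (flipFirst bs) ≡ walk r e bs
walk-flipFirst {r} (true ∷ bs) _ e<r = cong (λ e′ → walk r e′ bs) (prev-next (next< e<r))
walk-flipFirst {r} {e} (false ∷ bs) (there true∈) e<r = begin
  walk r (prev r (next r (next r e))) (flipFirst bs)    ≡⟨ cong (λ e′ → walk r e′ (flipFirst bs)) (prev-next (next< e<r)) ⟩
  walk r (next r e) (flipFirst bs)                      ≡⟨ cong (λ e′ → walk r (next r e′) (flipFirst bs)) (sym (next-prev e<r)) ⟩
  walk r (next r (next r (prev r e))) (flipFirst bs)    ≡⟨ walk-flipFirst bs true∈ (prev< e<r) ⟩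
  walk r (prev r e) bs                                  ∎
  where open ≡-Reasoning

all-false⊎true∈ : ∀ bs → All (_≡ false) bs ⊎ true ∈ bs
all-false⊎true∈ []           = inj₁ []
all-false⊎true∈ (true ∷ bs)  = inj₂ (here refl)
all-false⊎true∈ (false ∷ bs) = Sum.map (refl ∷_) there (all-false⊎true∈ bs)

walk-all-false : ∀ {r} → 2 ≤ r → ∀ {a} bs → All (_≡ false) bs → walk r (negMod a r) bs ≡ negMod (length bs + a) r
walk-all-false         2≤r     []           []          = refl
walk-all-false {r} 2≤r {a} (false ∷ bs) (refl ∷ fs) = begin
  walk r (prev r (negMod a r)) bs  ≡⟨ cong (λ e → walk r e bs) (sym (negMod-suc a 2≤r)) ⟩
  walk r (negMod (suc a) r) bs     ≡⟨ walk-all-false 2≤r bs fs ⟩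
  negMod (length bs + suc a) r     ≡⟨ cong (λ m → negMod m r) (+-suc (length bs) a) ⟩
  negMod (suc (length bs) + a) r   ∎
  where open ≡-Reasoning

-- The start row for k lies two rows above that for k + 1, so a walk with an upward step is
-- also a walk for k once its first upward step is turned into a downward one.
Reachable-step-down : ∀ {r n k x} → 2 ≤ r → 2 * suc k + 1 ≤ r → Reachable r n (suc k) x →
  x ≡ negMod (2 + n + 2 * suc k) r ⊎ Reachable r n k x
Reachable-step-down {r} {n} {k} 2≤r le (bs , refl , refl) with all-false⊎true∈ bs
... | inj₁ all-false = inj₁ (begin
  walk r (prev r B) bs             ≡⟨ cong (λ e → walk r (prev r e) bs) (∸≡negMod z<s le) ⟩
  walk r (prev r (negMod M r)) bs  ≡⟨ cong (λ e → walk r e bs) (sym (negMod-suc M 2≤r)) ⟩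
  walk r (negMod (suc M) r) bs     ≡⟨ walk-all-false 2≤r bs all-false ⟩
  negMod (length bs + suc M) r     ≡⟨ cong (λ m → negMod m r) (shift (length bs) k) ⟩
  negMod (2 + length bs + 2 * suc k) r ∎)
  where
  open ≡-Reasoning
  M = 2 * suc k + 1
  B = r ∸ M
  shift : ∀ n k → n + suc (2 * suc k + 1) ≡ 2 + n + 2 * suc k
  shift = solve-∀
... | inj₂ true∈ = inj₂ (flipFirst bs , length-flipFirst bs , sym (begin
  walk r (prev r (r ∸ (2 * k + 1))) (flipFirst bs)   ≡⟨ cong (λ e → walk r e (flipFirst bs)) start≡ ⟩
  walk r (next r (next r (prev r B))) (flipFirst bs) ≡⟨ walk-flipFirst bs true∈ (prev< B<r) ⟩
  walk r (prev r B) bs                               ∎))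
  where
  open ≡-Reasoning
  B = r ∸ (2 * suc k + 1)
  two-more : ∀ k → 2 * suc k + 1 ≡ 2 + (2 * k + 1)
  two-more = solve-∀
  le′ : 2 + (2 * k + 1) ≤ r
  le′ = subst (_≤ r) (two-more k) le
  ∸≡ : r ∸ (2 * k + 1) ≡ suc (suc B)
  ∸≡ = begin
    r ∸ (2 * k + 1)                       ≡⟨ m<n⇒n∸m≡1+n∸1+m (<-trans (n<1+n _) le′) ⟩
    suc (r ∸ (1 + (2 * k + 1)))           ≡⟨ cong suc (m<n⇒n∸m≡1+n∸1+m le′) ⟩
    suc (suc (r ∸ (2 + (2 * k + 1))))     ≡⟨ cong (λ m → suc (suc (r ∸ m))) (sym (two-more k)) ⟩
    suc (suc B)                           ∎
  sB<r : suc B < r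
  sB<r = subst (_≤ r) ∸≡ (m∸n≤m r (2 * k + 1))
  B<r : B < r
  B<r = <-trans (n<1+n B) sB<r
  start≡ : prev r (r ∸ (2 * k + 1)) ≡ next r (next r (prev r B))
  start≡ = begin
    prev r (r ∸ (2 * k + 1))       ≡⟨ cong (prev r) ∸≡ ⟩
    suc B                          ≡⟨ NextRow⇒≡next (inj₁ (sB<r , refl)) ⟩
    next r B                       ≡⟨ cong (next r) (sym (next-prev B<r)) ⟩
    next r (next r (prev r B))     ∎

GGPath-last-row : ∀ {r n k p x} → 2 ≤ r → GGPath r (2 + n) (suc k) p → last p ≡ just (x , suc n) →
  ¬ InA r (2 + n) k x → x ≡ modN (2 + n + 2 * suc k) r ⊎ x ≡ negMod (2 + n + 2 * suc k) r
GGPath-last-row {r} {n} {k} {p} {x} 2≤r (le , ham , rest , cbc , form) last≡ x∉A = [ form₁ , form₂ ]′ form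
  where
  N = 2 + n + 2 * suc k
  0<r = <-trans z<s 2≤r

  new-or-old : ∀ {y} → Reachable r n (suc k) y → y ≡ negMod N r ⊎ (InA r (2 + n) k y × InA r (2 + n) k (negMod y r))
  new-or-old reach = Sum.map₂ (λ reach′ → Reachable⇒InA {k = k} le′ reach′ , Reachable⇒InA-mirror {k = k} le′ reach′)
                                (Reachable-step-down 2≤r le reach)
    where le′ = ≤-trans (+-monoˡ-≤ 1 (*-monoʳ-≤ 2 (n≤1+n k))) le

  mirror-p≡ : p ≡ prefix2 r (suc k) ++ rest → map (mirror r) p ≡ prefix1 r (suc k) ++ map (mirror r) rest
  mirror-p≡ p≡ = trans (cong (map (mirror r)) p≡)
    (trans (map-++ (mirror r) (prefix2 r (suc k)) rest) (cong (_++ map (mirror r) rest) (mirror-prefix2 (suc k) le)))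

  x̄̄≡x : negMod (negMod x r) r ≡ x
  x̄̄≡x = trans (negMod-involutive x 0<r) (modN-< (proj₁ (All-lookup (proj₁ ham) (last-∈ p last≡))))

  unmirror : negMod x r ≡ negMod N r → x ≡ modN N r
  unmirror x̄≡ = trans (sym x̄̄≡x) (trans (cong (λ y → negMod y r) x̄≡) (negMod-involutive N 0<r))

  form₁ : p ≡ prefix1 r (suc k) ++ rest → x ≡ modN N r ⊎ x ≡ negMod N r
  form₁ p≡ = [ inj₂ , ⊥-elim ∘ x∉A ∘ proj₁ ]′
    (new-or-old (form1-Reachable {k = suc k} le (s≤s z≤n) ham cbc p≡ last≡))

  form₂ : p ≡ prefix2 r (suc k) ++ rest → x ≡ modN N r ⊎ x ≡ negMod N r
  form₂ p≡ = [ inj₁ ∘ unmirror , ⊥-elim ∘ x∉A ∘ subst (InA r (2 + n) k) x̄̄≡x ∘ proj₂ ]′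
    (new-or-old (form1-Reachable {k = suc k} le (s≤s z≤n) (mirror-HamiltonianPath ham) (mirror-ColumnByColumn {r} {2 + n} cbc)
                   (mirror-p≡ p≡) (trans (last-map (mirror r) p) (cong (Maybe.map (mirror r)) last≡))))

corollary1 : (r c m : ℕ) → 2 ≤ r → 2 ≤ c → 1 ≤ m →
    (x : ℕ) → InA r c m x → ¬ InA r c (m ∸ 1) x →
    x ≡ modN (c + 2 * m) r ⊎ x ≡ negMod (c + 2 * m) r
corollary1 r zero          _       _   ()        _  _ _ _
corollary1 r (suc zero)    _       _   (s≤s ())  _  _ _ _
corollary1 r (suc (suc n)) zero    _   _         () _ _ _
corollary1 r (suc (suc n)) (suc m) 2≤r _ _ x (k , p , gg , budget , last≡) x∉A with k ≤? m
... | yes k≤m = ⊥-elim (x∉A (k , p , gg , budget-mono n k≤m , last≡))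
... | no  k≰m with ≤-antisym (budget-cancel n budget) (≰⇒> k≰m)
...   | refl = GGPath-last-row 2≤r gg last≡ x∉A
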